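{- Fix $k\in\mathbb Z_{\ge0}$. Let $\Psi$ and $\Phi$ be the bijections from the set of $k$-MM triples onto the set of $k$-GC triples described in the context. Then $(\Psi^{ -1}\circ\Phi)^2$ is the identity on the set of $k$-MM triples and $(\Phi\circ\Psi^{ -1})^2$ is the identity on the set of $k$-GC triples. In particular, the inverse of $\Phi$ (on $k$-GC triples) equals $\Psi^{ -1}\circ\Phi\circ\Psi^{ -1}$.
   Context: Fix $k\in\mathbb Z_{\ge0}$. A $k$-GM triple is $(a,b,c)\in\mathbb Z_{\ge1}^3$ with $a^2+b^2+c^2+k(bc+ca+ab)=(3+3k)abc$; a $k$-GM number is an entry of some $k$-GM triple. Let $S=\begin{bmatrix}k&0\\3k^2+3k&k\end{bmatrix}$, $T=\begin{bmatrix}-1&0\\3k+3&-1\end{bmatrix}$. A $k$-GC matrix is $P\in SL(2,\mathbb Z)$ whose $(1,2)$-entry $p_{12}$ is a $k$-GM number and $\operatorname{tr}P=(3k+3)p_{12}-k$; a $k$-GC triple is a triple $(P,Q,R)$ of $k$-GC matrices with $Q=PR-S$ and $(p_{12},q_{12},r_{12})$ a $k$-GM triple. A $k$-MM matrix is $X\in SL(2,\mathbb Z)$ whose $(1,2)$-entry is a $k$-GM number and $\operatorname{tr}X=-k$; a $k$-MM triple is a triple $(X,Y,Z)$ of $k$-MM matrices with $XYZ=T$ whose $(1,2)$-entries form a $k$-GM triple. $\Psi(X,Y,Z)=(\psi(X),\psi(Y),\psi(Z))$ where \[\psi\begin{bmatrix} m_{11}&m_{12}\\ m_{21}&m_{22}\end{bmatrix}=\begin{bmatrix}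 -m_{11}+m_{12}k-k & m_{12}\\ m_{21}-(k+3)m_{11}+k(2k+3)(m_{12}-1) & -m_{22}+(2k+3)m_{12}-k\end{bmatrix},\] and $\Phi(X,Y,Z)=(-(YZ)^{ -1},-(XZ)^{ -1},-(XY)^{ -1})$. Both $\Psi$ and $\Phi$ restrict to bijections from the set of $k$-MM triples onto the set of $k$-GC triples. -}

module Defs where

open import Data.Nat using (ℕ)
open import Data.Integer using (ℤ; +_; _+_; _*_; -_; _-_; _≤_)
open import Data.Sum using (_⊎_)
open import Data.Product using (_×_; _,_; ∃)
open import Relation.Binary.PropositionalEquality using (_≡_; refl; cong₂)
open import Data.Integer.Tactic.RingSolver using (solve-∀)

record Mat : Set where
  constructor mat
  field
    m11 m12 m21 m22 : ℤ
open Mat public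

_·_ : Mat → Mat → Mat
mat a b c d · mat e f g h = mat (a * e + b * g) (a * f + b * h) (c * e + d * g) (c * f + d * h)

_⊖_ : Mat → Mat → Mat
mat a b c d ⊖ mat e f g h = mat (a - e) (b - f) (c - g) (d - h)

neg : Mat → Mat
neg (mat a b c d) = mat (- a) (- b) (- c) (- d)

det : Mat → ℤ
det (mat a b c d) = a * d - b * c

tr : Mat → ℤ
tr (mat a b c d) = a + d

SL2 : Mat → Set
SL2 M = det M ≡ + 1

-- inverse in SL(2,ℤ) (the adjugate; equals M⁻¹ whenever det M = 1)
inv : Mat → Mat
inv (mat a b c d) = mat d (- b) (- c) a

one : ℤ
one = + 1

Smat : ℕ → Mat
Smat k = mat (+ k) (+ 0) (+ 3 * (+ k * + k) + + 3 * + k) (+ k)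

Tmat : ℕ → Mat
Tmat k = mat (- one) (+ 0) (+ 3 * + k + + 3) (- one)

GMTriple : ℕ → ℤ → ℤ → ℤ → Set
GMTriple k a b c =
  (one ≤ a) × (one ≤ b) × (one ≤ c) ×
  (a * a + b * b + c * c + + k * (b * c + c * a + a * b)
     ≡ (+ 3 + + 3 * + k) * (a * (b * c)))

GMNumber : ℕ → ℤ → Set
GMNumber k x = ∃ λ b → ∃ λ c →
  GMTriple k x b c ⊎ GMTriple k b x c ⊎ GMTriple k b c x

GCMatrix : ℕ → Mat → Set
GCMatrix k P = SL2 P × GMNumber k (m12 P) × (tr P ≡ (+ 3 * + k + + 3) * m12 P - + k)

MMMatrix : ℕ → Mat → Set
MMMatrix k X = SL2 X × GMNumber k (m12 X) × (tr X ≡ - (+ k))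

Triple : Set
Triple = Mat × Mat × Mat

GCTriple : ℕ → Triple → Set
GCTriple k (P , Q , R) =
  GCMatrix k P × GCMatrix k Q × GCMatrix k R ×
  (Q ≡ (P · R) ⊖ Smat k) × GMTriple k (m12 P) (m12 Q) (m12 R)

MMTriple : ℕ → Triple → Set
MMTriple k (X , Y , Z) =
  MMMatrix k X × MMMatrix k Y × MMMatrix k Z ×
  ((X · Y) · Z ≡ Tmat k) × GMTriple k (m12 X) (m12 Y) (m12 Z)

ψ : ℕ → Mat → Mat
ψ k (mat a b c d) =
  mat (- a + b * + k - + k)
      b
      (c - (+ k + + 3) * a + + k * (+ 2 * + k + + 3) * (b - one))
      (- d + (+ 2 * + k + + 3) * b - + k)

ψ⁻¹ : ℕ → Mat → Mat
ψ⁻¹ k (mat a b c d) =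
  mat (- a + b * + k - + k)
      b
      (c + (+ k + + 3) * (- a + b * + k - + k) - + k * (+ 2 * + k + + 3) * (b - one))
      (- d + (+ 2 * + k + + 3) * b - + k)

Ψ : ℕ → Triple → Triple
Ψ k (X , Y , Z) = ψ k X , ψ k Y , ψ k Z

Ψ⁻¹ : ℕ → Triple → Triple
Ψ⁻¹ k (P , Q , R) = ψ⁻¹ k P , ψ⁻¹ k Q , ψ⁻¹ k R

Φ : Triple → Triple
Φ (X , Y , Z) = neg (inv (Y · Z)) , neg (inv (X · Z)) , neg (inv (X · Y))

private
  cong₄ : ∀ {a b c d a' b' c' d' : ℤ} → a ≡ a' → b ≡ b' → c ≡ c' → d ≡ d' →
          mat a b c d ≡ mat a' b' c' d'
  cong₄ refl refl refl refl = refl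

  e1 : ∀ a b k → - (- a + b * k - k) + b * k - k ≡ a
  e1 = solve-∀
  e3 : ∀ a b c k → c - (k + + 3) * a + k * (+ 2 * k + + 3) * (b - + 1)
         + (k + + 3) * (- (- a + b * k - k) + b * k - k) - k * (+ 2 * k + + 3) * (b - + 1) ≡ c
  e3 = solve-∀
  e3' : ∀ a b c k → c + (k + + 3) * (- a + b * k - k) - k * (+ 2 * k + + 3) * (b - + 1)
         - (k + + 3) * (- a + b * k - k) + k * (+ 2 * k + + 3) * (b - + 1) ≡ c
  e3' = solve-∀
  e4 : ∀ b d k → - (- d + (+ 2 * k + + 3) * b - k) + (+ 2 * k + + 3) * b - k ≡ d
  e4 = solve-∀

ψ⁻¹∘ψ : ∀ k M → ψ⁻¹ k (ψ k M) ≡ M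
ψ⁻¹∘ψ k (mat a b c d) = cong₄ (e1 a b (+ k)) refl (e3 a b c (+ k)) (e4 b d (+ k))

ψ∘ψ⁻¹ : ∀ k M → ψ k (ψ⁻¹ k M) ≡ M
ψ∘ψ⁻¹ k (mat a b c d) = cong₄ (e1 a b (+ k)) refl (e3' a b c (+ k)) (e4 b d (+ k))

{-# OPTIONS --safe #-}
-- On matrices of trace −k, ψ is X ↦ (G X H)⁻¹ for the two reflections G = [[1,0],[−k,−1]]
-- and H = [[1,0],[2k+3,−1]]; on matrices with the GC trace condition, ψ⁻¹ is P ↦ G P⁻¹ H;
-- and HG = −T⁻¹. Hence Ψ⁻¹∘Φ sends (X,Y,Z) with XYZ = T to (−G·YZ·H, −G·XZ·H, −G·XY·H),
-- and one more Φ gives (ψX, ψY, ψZ), because XYZ = T turns XZ·HG·XY, YZ·HG·XY, YZ·HG·XZ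
-- into −X, −Y, −Z. So Φ∘Ψ⁻¹∘Φ = Ψ on such triples. This yields (Ψ⁻¹∘Φ)² = id at once, and
-- (Φ∘Ψ⁻¹)² = id once Ψ⁻¹ is seen to map GC triples to triples with XYZ = T, which follows
-- from Q⁻¹ = −T·PR·T.
module Submission where

open import Defs
open import Data.Nat using (ℕ)
open import Data.Integer using (ℤ; +_; _+_; _*_; -_; _-_)
open import Data.Integer.Properties using (neg-involutive; neg-distrib-+; +-inverseʳ)
open import Data.Integer.Tactic.RingSolver using (solve-∀)
open import Data.Product using (_×_; _,_)
open import Relation.Binary.PropositionalEquality using (_≡_; refl; sym; trans; cong; cong₂; subst; module ≡-Reasoning)

mat-cong : ∀ {a b c d a′ b′ c′ d′} → a ≡ a′ → b ≡ b′ → c ≡ c′ → d ≡ d′ →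
           mat a b c d ≡ mat a′ b′ c′ d′
mat-cong refl refl refl refl = refl

I : Mat
I = mat (+ 1) (+ 0) (+ 0) (+ 1)

·-assoc : ∀ A B C → (A · B) · C ≡ A · (B · C)
·-assoc (mat a b c d) (mat e f g h) (mat p q r s) =
  mat-cong (entry a b e f g h p r) (entry a b e f g h q s)
           (entry c d e f g h p r) (entry c d e f g h q s)
  where
  entry : ∀ a b e f g h p r →
    (a * e + b * g) * p + (a * f + b * h) * r ≡ a * (e * p + f * r) + b * (g * p + h * r)
  entry = solve-∀

·-identityˡ : ∀ A → I · A ≡ A
·-identityˡ (mat a b c d) = mat-cong (one-zero a c) (one-zero b d) (zero-one a c) (zero-one b d)
  where
  one-zero : ∀ x y → + 1 * x + + 0 * y ≡ x
  one-zero = solve-∀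
  zero-one : ∀ x y → + 0 * x + + 1 * y ≡ y
  zero-one = solve-∀

·-identityʳ : ∀ A → A · I ≡ A
·-identityʳ (mat a b c d) = mat-cong (one-zero a b) (zero-one a b) (one-zero c d) (zero-one c d)
  where
  one-zero : ∀ x y → x * + 1 + y * + 0 ≡ x
  one-zero = solve-∀
  zero-one : ∀ x y → x * + 0 + y * + 1 ≡ y
  zero-one = solve-∀

neg-involutive-mat : ∀ A → neg (neg A) ≡ A
neg-involutive-mat (mat a b c d) =
  mat-cong (neg-involutive a) (neg-involutive b) (neg-involutive c) (neg-involutive d)

neg-·ˡ : ∀ A B → neg A · B ≡ neg (A · B)
neg-·ˡ (mat a b c d) (mat e f g h) = mat-cong (entry a b e g) (entry a b f h) (entry c d e g) (entry c d f h)
  where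
  entry : ∀ a b e g → (- a) * e + (- b) * g ≡ - (a * e + b * g)
  entry = solve-∀

neg-·ʳ : ∀ A B → A · neg B ≡ neg (A · B)
neg-·ʳ (mat a b c d) (mat e f g h) = mat-cong (entry a b e g) (entry a b f h) (entry c d e g) (entry c d f h)
  where
  entry : ∀ a b e g → a * (- e) + b * (- g) ≡ - (a * e + b * g)
  entry = solve-∀

inv-involutive : ∀ A → inv (inv A) ≡ A
inv-involutive (mat a b c d) = mat-cong refl (neg-involutive b) (neg-involutive c) refl

inv-· : ∀ A B → inv (A · B) ≡ inv B · inv A
inv-· (mat a b c d) (mat e f g h) =
  mat-cong (entry₁₁ c d f h) (entry₁₂ a b f h) (entry₂₁ c d e g) (entry₂₂ a b e g)
  where
  entry₁₁ : ∀ c d f h → c * f + d * h ≡ h * d + (- f) * (- c)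
  entry₁₁ = solve-∀
  entry₁₂ : ∀ a b f h → - (a * f + b * h) ≡ h * (- b) + (- f) * a
  entry₁₂ = solve-∀
  entry₂₁ : ∀ c d e g → - (c * e + d * g) ≡ (- g) * d + e * (- c)
  entry₂₁ = solve-∀
  entry₂₂ : ∀ a b e g → a * e + b * g ≡ (- g) * (- b) + e * a
  entry₂₂ = solve-∀

inv-inverseˡ : ∀ A → SL2 A → inv A · A ≡ I
inv-inverseˡ (mat a b c d) det≡1 =
  mat-cong (trans (entry₁₁ a b c d) det≡1) (entry₁₂ b d) (entry₂₁ a c) (trans (entry₂₂ a b c d) det≡1)
  where
  entry₁₁ : ∀ a b c d → d * a + (- b) * c ≡ a * d - b * c
  entry₁₁ = solve-∀
  entry₁₂ : ∀ b d → d * b + (- b) * d ≡ + 0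
  entry₁₂ = solve-∀
  entry₂₁ : ∀ a c → (- c) * a + a * c ≡ + 0
  entry₂₁ = solve-∀
  entry₂₂ : ∀ a b c d → (- c) * b + a * d ≡ a * d - b * c
  entry₂₂ = solve-∀

inv-inverseʳ : ∀ A → SL2 A → A · inv A ≡ I
inv-inverseʳ (mat a b c d) det≡1 =
  mat-cong (trans (entry₁₁ a b c d) det≡1) (entry₁₂ a b) (entry₂₁ c d) (trans (entry₂₂ a b c d) det≡1)
  where
  entry₁₁ : ∀ a b c d → a * d + b * (- c) ≡ a * d - b * c
  entry₁₁ = solve-∀
  entry₁₂ : ∀ a b → a * (- b) + b * a ≡ + 0
  entry₁₂ = solve-∀
  entry₂₁ : ∀ c d → c * d + d * (- c) ≡ + 0
  entry₂₁ = solve-∀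
  entry₂₂ : ∀ a b c d → c * (- b) + d * a ≡ a * d - b * c
  entry₂₂ = solve-∀

inv-cancelˡ : ∀ A B → SL2 A → inv A · (A · B) ≡ B
inv-cancelˡ A B det≡1 = begin
  inv A · (A · B) ≡⟨ sym (·-assoc (inv A) A B) ⟩
  (inv A · A) · B ≡⟨ cong (_· B) (inv-inverseˡ A det≡1) ⟩
  I · B           ≡⟨ ·-identityˡ B ⟩
  B               ∎
  where open ≡-Reasoning

inv-cancelʳ : ∀ A B → SL2 A → (B · A) · inv A ≡ B
inv-cancelʳ A B det≡1 = begin
  (B · A) · inv A ≡⟨ ·-assoc B A (inv A) ⟩
  B · (A · inv A) ≡⟨ cong (B ·_) (inv-inverseʳ A det≡1) ⟩
  B · I           ≡⟨ ·-identityʳ B ⟩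
  B               ∎
  where open ≡-Reasoning

det-· : ∀ A B → det (A · B) ≡ det A * det B
det-· (mat a b c d) (mat e f g h) = expand a b c d e f g h
  where
  expand : ∀ a b c d e f g h →
    (a * e + b * g) * (c * f + d * h) - (a * f + b * h) * (c * e + d * g) ≡ (a * d - b * c) * (e * h - f * g)
  expand = solve-∀

det-inv : ∀ A → det (inv A) ≡ det A
det-inv (mat a b c d) = expand a b c d
  where
  expand : ∀ a b c d → d * a - (- b) * (- c) ≡ a * d - b * c
  expand = solve-∀

SL2-· : ∀ A B → SL2 A → SL2 B → SL2 (A · B)
SL2-· A B detA≡1 detB≡1 = trans (det-· A B) (cong₂ _*_ detA≡1 detB≡1)

tr-comm : ∀ A B → tr (A · B) ≡ tr (B · A)
tr-comm (mat a b c d) (mat e f g h) = expand a b c d e f g h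
  where
  expand : ∀ a b c d e f g h → (a * e + b * g) + (c * f + d * h) ≡ (e * a + f * c) + (g * b + h * d)
  expand = solve-∀

tr-conj : ∀ A M → SL2 A → tr ((A · M) · inv A) ≡ tr M
tr-conj A M det≡1 = trans (tr-comm (A · M) (inv A)) (cong tr (inv-cancelˡ A M det≡1))

tr-neg : ∀ M → tr (neg M) ≡ - tr M
tr-neg (mat a b c d) = sym (neg-distrib-+ a d)

triple-cong : ∀ {A B C A′ B′ C′ : Mat} → A ≡ A′ → B ≡ B′ → C ≡ C′ →
              (A , B , C) ≡ (A′ , B′ , C′)
triple-cong refl refl refl = refl

neg-·-neg : ∀ A B → neg A · neg B ≡ A · B
neg-·-neg A B = begin
  neg A · neg B      ≡⟨ neg-·ˡ A (neg B) ⟩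
  neg (A · neg B)    ≡⟨ cong neg (neg-·ʳ A B) ⟩
  neg (neg (A · B))  ≡⟨ neg-involutive-mat (A · B) ⟩
  A · B              ∎
  where open ≡-Reasoning

x+y≡s⇒y≡s-x : ∀ x y {s} → x + y ≡ s → y ≡ s - x
x+y≡s⇒y≡s-x x y refl = isolate x y
  where
  isolate : ∀ x y → y ≡ (x + y) - x
  isolate = solve-∀

reflection : ℤ → Mat
reflection x = mat (+ 1) (+ 0) x (- + 1)

reflection-· : ∀ x y → reflection x · reflection y ≡ mat (+ 1) (+ 0) (x - y) (+ 1)
reflection-· x y = mat-cong refl refl (entry₂₁ x y) (entry₂₂ x)
  where
  entry₂₁ : ∀ x y → x * + 1 + (- + 1) * y ≡ x - y
  entry₂₁ = solve-∀
  entry₂₂ : ∀ x → x * + 0 + (- + 1) * (- + 1) ≡ + 1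
  entry₂₂ = solve-∀

reflection-involutive : ∀ x → reflection x · reflection x ≡ I
reflection-involutive x =
  trans (reflection-· x x) (cong (λ s → mat (+ 1) (+ 0) s (+ 1)) (+-inverseʳ x))

module _ (k : ℕ) where

  G H T : Mat
  G = reflection (- + k)
  H = reflection (+ 2 * + k + + 3)
  T = Tmat k

  ϑ : Mat → Mat
  ϑ M = (G · M) · H

  SL2-T : SL2 T
  SL2-T = refl

  H·G≡-T⁻¹ : H · G ≡ neg (inv T)
  H·G≡-T⁻¹ = trans (reflection-· (+ 2 * + k + + 3) (- + k))
                   (cong (λ s → mat (+ 1) (+ 0) s (+ 1)) (difference (+ k)))
    where
    difference : ∀ K → (+ 2 * K + + 3) - (- K) ≡ - (- (+ 3 * K + + 3))
    difference = solve-∀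

  -G·H≡T : neg (G · H) ≡ T
  -G·H≡T = trans (cong neg (reflection-· (- + k) (+ 2 * + k + + 3)))
                 (cong (λ s → mat (- + 1) (+ 0) s (- + 1)) (difference (+ k)))
    where
    difference : ∀ K → - (- K - (+ 2 * K + + 3)) ≡ + 3 * K + + 3
    difference = solve-∀

  HG·TA≡-A : ∀ A → (H · G) · (T · A) ≡ neg A
  HG·TA≡-A A = begin
    (H · G) · (T · A)     ≡⟨ cong (_· (T · A)) H·G≡-T⁻¹ ⟩
    neg (inv T) · (T · A) ≡⟨ neg-·ˡ (inv T) (T · A) ⟩
    neg (inv T · (T · A)) ≡⟨ cong neg (inv-cancelˡ T A SL2-T) ⟩
    neg A                 ∎
    where open ≡-Reasoning

  T·HGA≡-A : ∀ A → T · ((H · G) · A) ≡ neg A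
  T·HGA≡-A A = begin
    T · ((H · G) · A)     ≡⟨ cong (λ m → T · (m · A)) H·G≡-T⁻¹ ⟩
    T · (neg (inv T) · A) ≡⟨ cong (T ·_) (neg-·ˡ (inv T) A) ⟩
    T · neg (inv T · A)   ≡⟨ neg-·ʳ T (inv T · A) ⟩
    neg (T · (inv T · A)) ≡⟨ cong neg (sym (·-assoc T (inv T) A)) ⟩
    neg ((T · inv T) · A) ≡⟨ cong (λ m → neg (m · A)) (inv-inverseʳ T SL2-T) ⟩
    neg (I · A)           ≡⟨ cong neg (·-identityˡ A) ⟩
    neg A                 ∎
    where open ≡-Reasoning

  ϑ-involutive : ∀ M → ϑ (ϑ M) ≡ M
  ϑ-involutive M = begin
    (G · ((G · M) · H)) · H ≡⟨ cong (_· H) (sym (·-assoc G (G · M) H)) ⟩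
    ((G · (G · M)) · H) · H ≡⟨ ·-assoc (G · (G · M)) H H ⟩
    (G · (G · M)) · (H · H) ≡⟨ cong₂ _·_ (sym (·-assoc G G M))
                                          (reflection-involutive (+ 2 * + k + + 3)) ⟩
    ((G · G) · M) · I       ≡⟨ ·-identityʳ ((G · G) · M) ⟩
    (G · G) · M             ≡⟨ cong (_· M) (reflection-involutive (- + k)) ⟩
    I · M                   ≡⟨ ·-identityˡ M ⟩
    M                       ∎
    where open ≡-Reasoning

  ϑ-neg : ∀ M → ϑ (neg M) ≡ neg (ϑ M)
  ϑ-neg M = trans (cong (_· H) (neg-·ʳ G M)) (neg-·ˡ (G · M) H)

  ϑ-· : ∀ A B → ϑ A · ϑ B ≡ ϑ (A · ((H · G) · B))
  ϑ-· A B = begin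
    ((G · A) · H) · ((G · B) · H) ≡⟨ sym (·-assoc ((G · A) · H) (G · B) H) ⟩
    (((G · A) · H) · (G · B)) · H ≡⟨ cong (_· H) (·-assoc (G · A) H (G · B)) ⟩
    ((G · A) · (H · (G · B))) · H ≡⟨ cong (_· H) (·-assoc G A (H · (G · B))) ⟩
    (G · (A · (H · (G · B)))) · H ≡⟨ cong (λ m → (G · (A · m)) · H) (sym (·-assoc H G B)) ⟩
    (G · (A · ((H · G) · B))) · H ∎
    where open ≡-Reasoning

  ϑ-neg-I : ϑ (neg I) ≡ T
  ϑ-neg-I = trans (ϑ-neg I) (trans (cong (λ m → neg (m · H)) (·-identityʳ G)) -G·H≡T)

  HasMMTrace : Mat → Set
  HasMMTrace M = tr M ≡ - + k

  HasGCTrace : Mat → Set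
  HasGCTrace P = tr P ≡ (+ 3 * + k + + 3) * m12 P - + k

  tr-T·⇒HasGCTrace : ∀ P → tr (T · P) ≡ + k → HasGCTrace P
  tr-T·⇒HasGCTrace (mat a b c d) tr≡ =
    trans (expand a b c d (+ k)) (cong (λ s → (+ 3 * + k + + 3) * b - s) tr≡)
    where
    expand : ∀ a b c d K →
      a + d ≡ (+ 3 * K + + 3) * b - (((- + 1) * a + + 0 * c) + ((+ 3 * K + + 3) * b + (- + 1) * d))
    expand = solve-∀

  ψ≡inv∘ϑ : ∀ M → HasMMTrace M → ψ k M ≡ inv (ϑ M)
  ψ≡inv∘ϑ (mat a b c d) tr≡ rewrite x+y≡s⇒y≡s-x a d tr≡ =
    mat-cong (entry₁₁ a b c (+ k)) (entry₁₂ a b c (+ k)) (entry₂₁ a b c (+ k)) (entry₂₂ a b c (+ k))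
    where
    -- After eliminating d by the trace condition, each entry is a ring identity, stated with
    -- the right-hand side in the unsimplified shape that the matrix product computes to.
    entry₁₁ : ∀ a b c K → let d = - K - a in
      - a + b * K - K ≡ ((- K) * a + (- + 1) * c) * + 0 + ((- K) * b + (- + 1) * d) * (- + 1)
    entry₁₁ = solve-∀
    entry₁₂ : ∀ a b c K → let d = - K - a in
      b ≡ - ((+ 1 * a + + 0 * c) * + 0 + (+ 1 * b + + 0 * d) * (- + 1))
    entry₁₂ = solve-∀
    entry₂₁ : ∀ a b c K → let d = - K - a in
      c - (K + + 3) * a + K * (+ 2 * K + + 3) * (b - + 1)
        ≡ - (((- K) * a + (- + 1) * c) * + 1 + ((- K) * b + (- + 1) * d) * (+ 2 * K + + 3))
    entry₂₁ = solve-∀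
    entry₂₂ : ∀ a b c K → let d = - K - a in
      - d + (+ 2 * K + + 3) * b - K ≡ (+ 1 * a + + 0 * c) * + 1 + (+ 1 * b + + 0 * d) * (+ 2 * K + + 3)
    entry₂₂ = solve-∀

  tr-ψ⁻¹ : ∀ P → HasGCTrace P → HasMMTrace (ψ⁻¹ k P)
  tr-ψ⁻¹ (mat a b c d) tr≡ rewrite x+y≡s⇒y≡s-x a d tr≡ = expand a b (+ k)
    where
    expand : ∀ a b K → let d = ((+ 3 * K + + 3) * b - K) - a in
      (- a + b * K - K) + (- d + (+ 2 * K + + 3) * b - K) ≡ - K
    expand = solve-∀

  ψ⁻¹≡ϑ∘inv : ∀ P → HasGCTrace P → ψ⁻¹ k P ≡ ϑ (inv P)
  ψ⁻¹≡ϑ∘inv P tr≡ = begin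
    ψ⁻¹ k P                        ≡⟨ sym (ϑ-involutive (ψ⁻¹ k P)) ⟩
    ϑ (ϑ (ψ⁻¹ k P))                ≡⟨ cong ϑ (sym (inv-involutive (ϑ (ψ⁻¹ k P)))) ⟩
    ϑ (inv (inv (ϑ (ψ⁻¹ k P))))    ≡⟨ cong (λ m → ϑ (inv m)) (sym (ψ≡inv∘ϑ (ψ⁻¹ k P) (tr-ψ⁻¹ P tr≡))) ⟩
    ϑ (inv (ψ k (ψ⁻¹ k P)))        ≡⟨ cong (λ m → ϑ (inv m)) (ψ∘ψ⁻¹ k P) ⟩
    ϑ (inv P)                      ∎
    where open ≡-Reasoning

  HasGCTrace-⊖S⇒tr≡ : ∀ M → HasGCTrace (M ⊖ Smat k) →
                      tr M ≡ (+ 3 * + k + + 3) * m12 M + + k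
  HasGCTrace-⊖S⇒tr≡ (mat a b c d) tr≡ =
    trans (shift a d (+ k)) (trans (cong (_+ (+ k + + k)) tr≡) (simplify b (+ k)))
    where
    shift : ∀ a d K → a + d ≡ ((a - K) + (d - K)) + (K + K)
    shift = solve-∀
    simplify : ∀ b K → ((+ 3 * K + + 3) * (b - + 0) - K) + (K + K) ≡ (+ 3 * K + + 3) * b + K
    simplify = solve-∀

  inv-⊖S : ∀ M → HasGCTrace (M ⊖ Smat k) → inv (M ⊖ Smat k) ≡ neg ((T · M) · T)
  inv-⊖S (mat a b c d) tr≡ rewrite x+y≡s⇒y≡s-x a d (HasGCTrace-⊖S⇒tr≡ (mat a b c d) tr≡) =
    mat-cong (entry₁₁ a b c (+ k)) (entry₁₂ a b c (+ k)) (entry₂₁ a b c (+ k)) (entry₂₂ a b c (+ k))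
    where
    entry₁₁ : ∀ a b c K → let d = (+ 3 * K + + 3) * b + K - a in
      d - K ≡ - (((- + 1) * a + + 0 * c) * (- + 1) + ((- + 1) * b + + 0 * d) * (+ 3 * K + + 3))
    entry₁₁ = solve-∀
    entry₁₂ : ∀ a b c K → let d = (+ 3 * K + + 3) * b + K - a in
      - (b - + 0) ≡ - (((- + 1) * a + + 0 * c) * + 0 + ((- + 1) * b + + 0 * d) * (- + 1))
    entry₁₂ = solve-∀
    entry₂₁ : ∀ a b c K → let d = (+ 3 * K + + 3) * b + K - a in
      - (c - (+ 3 * (K * K) + + 3 * K))
        ≡ - (((+ 3 * K + + 3) * a + (- + 1) * c) * (- + 1)
             + ((+ 3 * K + + 3) * b + (- + 1) * d) * (+ 3 * K + + 3))
    entry₂₁ = solve-∀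
    entry₂₂ : ∀ a b c K → let d = (+ 3 * K + + 3) * b + K - a in
      a - K ≡ - (((+ 3 * K + + 3) * a + (- + 1) * c) * + 0
                 + ((+ 3 * K + + 3) * b + (- + 1) * d) * (- + 1))
    entry₂₂ = solve-∀

  ψ⁻¹∘neg∘inv≡neg∘ϑ : ∀ A → tr (T · inv A) ≡ - + k → ψ⁻¹ k (neg (inv A)) ≡ neg (ϑ A)
  ψ⁻¹∘neg∘inv≡neg∘ϑ A tr≡ = begin
    ψ⁻¹ k (neg (inv A))    ≡⟨ ψ⁻¹≡ϑ∘inv (neg (inv A)) (tr-T·⇒HasGCTrace (neg (inv A)) tr-T·-A⁻¹) ⟩
    ϑ (neg (inv (inv A)))  ≡⟨ cong (λ m → ϑ (neg m)) (inv-involutive A) ⟩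
    ϑ (neg A)              ≡⟨ ϑ-neg A ⟩
    neg (ϑ A)              ∎
    where
    open ≡-Reasoning
    tr-T·-A⁻¹ : tr (T · neg (inv A)) ≡ + k
    tr-T·-A⁻¹ = begin
      tr (T · neg (inv A)) ≡⟨ cong tr (neg-·ʳ T (inv A)) ⟩
      tr (neg (T · inv A)) ≡⟨ tr-neg (T · inv A) ⟩
      - tr (T · inv A)     ≡⟨ cong -_ tr≡ ⟩
      - - + k              ≡⟨ neg-involutive (+ k) ⟩
      + k                  ∎

  neg-inv[neg-ϑ·neg-ϑ]≡ψ : ∀ A B M → A · ((H · G) · B) ≡ neg M → HasMMTrace M →
                           neg (inv (neg (ϑ A) · neg (ϑ B))) ≡ ψ k M
  neg-inv[neg-ϑ·neg-ϑ]≡ψ A B M A·HG·B≡-M tr≡ = begin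
    neg (inv (neg (ϑ A) · neg (ϑ B)))  ≡⟨ cong (λ m → neg (inv m)) (neg-·-neg (ϑ A) (ϑ B)) ⟩
    neg (inv (ϑ A · ϑ B))              ≡⟨ cong (λ m → neg (inv m)) (ϑ-· A B) ⟩
    neg (inv (ϑ (A · ((H · G) · B))))  ≡⟨ cong (λ m → neg (inv (ϑ m))) A·HG·B≡-M ⟩
    neg (inv (ϑ (neg M)))              ≡⟨ cong (λ m → neg (inv m)) (ϑ-neg M) ⟩
    neg (neg (inv (ϑ M)))              ≡⟨ neg-involutive-mat (inv (ϑ M)) ⟩
    inv (ϑ M)                          ≡⟨ sym (ψ≡inv∘ϑ M tr≡) ⟩
    ψ k M                              ∎
    where open ≡-Reasoning

  WeakMMTriple : Triple → Set
  WeakMMTriple (X , Y , Z) =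
    (SL2 X × SL2 Y × SL2 Z) × (HasMMTrace X × HasMMTrace Y × HasMMTrace Z) × (X · Y) · Z ≡ T

  Φ∘Ψ⁻¹∘Φ≡Ψ : ∀ t → WeakMMTriple t → Φ (Ψ⁻¹ k (Φ t)) ≡ Ψ k t
  Φ∘Ψ⁻¹∘Φ≡Ψ (X , Y , Z) ((detX , detY , detZ) , (trX , trY , trZ) , XY·Z≡T) = begin
    Φ (Ψ⁻¹ k (Φ (X , Y , Z)))
      ≡⟨ cong Φ (triple-cong (ψ⁻¹∘neg∘inv≡neg∘ϑ (Y · Z) trT·YZ⁻¹)
                             (ψ⁻¹∘neg∘inv≡neg∘ϑ (X · Z) trT·XZ⁻¹)
                             (ψ⁻¹∘neg∘inv≡neg∘ϑ (X · Y) trT·XY⁻¹)) ⟩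
    Φ (neg (ϑ (Y · Z)) , neg (ϑ (X · Z)) , neg (ϑ (X · Y)))
      ≡⟨ triple-cong (neg-inv[neg-ϑ·neg-ϑ]≡ψ (X · Z) (X · Y) X (AZ·HG·XY≡-A X) trX)
                     (neg-inv[neg-ϑ·neg-ϑ]≡ψ (Y · Z) (X · Y) Y (AZ·HG·XY≡-A Y) trY)
                     (neg-inv[neg-ϑ·neg-ϑ]≡ψ (Y · Z) (X · Z) Z YZ·HG·XZ≡-Z trZ) ⟩
    Ψ k (X , Y , Z)
      ∎
    where
    open ≡-Reasoning
    X·YZ≡T : X · (Y · Z) ≡ T
    X·YZ≡T = trans (sym (·-assoc X Y Z)) XY·Z≡T

    trT·YZ⁻¹ : tr (T · inv (Y · Z)) ≡ - + k
    trT·YZ⁻¹ = begin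
      tr (T · inv (Y · Z))             ≡⟨ cong (λ m → tr (m · inv (Y · Z))) (sym X·YZ≡T) ⟩
      tr ((X · (Y · Z)) · inv (Y · Z)) ≡⟨ cong tr (inv-cancelʳ (Y · Z) X (SL2-· Y Z detY detZ)) ⟩
      tr X                             ≡⟨ trX ⟩
      - + k                            ∎

    trT·XZ⁻¹ : tr (T · inv (X · Z)) ≡ - + k
    trT·XZ⁻¹ = begin
      tr (T · inv (X · Z))                   ≡⟨ cong₂ (λ m n → tr (m · n)) (sym XY·Z≡T) (inv-· X Z) ⟩
      tr (((X · Y) · Z) · (inv Z · inv X))   ≡⟨ cong tr (sym (·-assoc ((X · Y) · Z) (inv Z) (inv X))) ⟩
      tr ((((X · Y) · Z) · inv Z) · inv X)   ≡⟨ cong (λ m → tr (m · inv X)) (inv-cancelʳ Z (X · Y) detZ) ⟩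
      tr ((X · Y) · inv X)                   ≡⟨ tr-conj X Y detX ⟩
      tr Y                                   ≡⟨ trY ⟩
      - + k                                  ∎

    trT·XY⁻¹ : tr (T · inv (X · Y)) ≡ - + k
    trT·XY⁻¹ = begin
      tr (T · inv (X · Y))                 ≡⟨ cong (λ m → tr (m · inv (X · Y))) (sym XY·Z≡T) ⟩
      tr (((X · Y) · Z) · inv (X · Y))     ≡⟨ tr-conj (X · Y) Z (SL2-· X Y detX detY) ⟩
      tr Z                                 ≡⟨ trZ ⟩
      - + k                                ∎

    AZ·HG·XY≡-A : ∀ A → (A · Z) · ((H · G) · (X · Y)) ≡ neg A
    AZ·HG·XY≡-A A = begin
      (A · Z) · ((H · G) · (X · Y))        ≡⟨ cong (λ m → (A · Z) · ((H · G) · m)) X·Y≡T·Z⁻¹ ⟩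
      (A · Z) · ((H · G) · (T · inv Z))    ≡⟨ cong ((A · Z) ·_) (HG·TA≡-A (inv Z)) ⟩
      (A · Z) · neg (inv Z)                ≡⟨ neg-·ʳ (A · Z) (inv Z) ⟩
      neg ((A · Z) · inv Z)                ≡⟨ cong neg (inv-cancelʳ Z A detZ) ⟩
      neg A                                ∎
      where
      X·Y≡T·Z⁻¹ : X · Y ≡ T · inv Z
      X·Y≡T·Z⁻¹ = trans (sym (inv-cancelʳ Z (X · Y) detZ)) (cong (_· inv Z) XY·Z≡T)

    YZ·HG·XZ≡-Z : (Y · Z) · ((H · G) · (X · Z)) ≡ neg Z
    YZ·HG·XZ≡-Z = begin
      (Y · Z) · ((H · G) · (X · Z))        ≡⟨ cong (_· ((H · G) · (X · Z))) Y·Z≡X⁻¹·T ⟩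
      (inv X · T) · ((H · G) · (X · Z))    ≡⟨ ·-assoc (inv X) T ((H · G) · (X · Z)) ⟩
      inv X · (T · ((H · G) · (X · Z)))    ≡⟨ cong (inv X ·_) (T·HGA≡-A (X · Z)) ⟩
      inv X · neg (X · Z)                  ≡⟨ neg-·ʳ (inv X) (X · Z) ⟩
      neg (inv X · (X · Z))                ≡⟨ cong neg (inv-cancelˡ X Z detX) ⟩
      neg Z                                ∎
      where
      Y·Z≡X⁻¹·T : Y · Z ≡ inv X · T
      Y·Z≡X⁻¹·T = trans (sym (inv-cancelˡ X (Y · Z) detX)) (cong (inv X ·_) X·YZ≡T)

  SL2-ψ⁻¹ : ∀ P → SL2 P → HasGCTrace P → SL2 (ψ⁻¹ k P)
  SL2-ψ⁻¹ P det≡1 tr≡ = begin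
    det (ψ⁻¹ k P)                    ≡⟨ cong det (ψ⁻¹≡ϑ∘inv P tr≡) ⟩
    det ((G · inv P) · H)            ≡⟨ det-· (G · inv P) H ⟩
    det (G · inv P) * det H          ≡⟨ cong (_* det H) (det-· G (inv P)) ⟩
    (det G * det (inv P)) * det H    ≡⟨ cong (λ d → (det G * d) * det H) (trans (det-inv P) det≡1) ⟩
    (det G * + 1) * det H            ≡⟨⟩
    + 1                              ∎
    where open ≡-Reasoning

  Ψ⁻¹-WeakMMTriple : ∀ s → GCTriple k s → WeakMMTriple (Ψ⁻¹ k s)
  Ψ⁻¹-WeakMMTriple (P , Q , R)
                   ((detP , _ , trP) , (detQ , _ , trQ) , (detR , _ , trR) , Q≡PR-S , _) =
    (SL2-ψ⁻¹ P detP trP , SL2-ψ⁻¹ Q detQ trQ , SL2-ψ⁻¹ R detR trR) ,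
    (tr-ψ⁻¹ P trP , tr-ψ⁻¹ Q trQ , tr-ψ⁻¹ R trR) ,
    product
    where
    open ≡-Reasoning
    Q⁻¹≡-T·PR·T : inv Q ≡ neg ((T · (P · R)) · T)
    Q⁻¹≡-T·PR·T = trans (cong inv Q≡PR-S) (inv-⊖S (P · R) (subst HasGCTrace Q≡PR-S trQ))

    HG·Q⁻¹ : (H · G) · inv Q ≡ (P · R) · T
    HG·Q⁻¹ = begin
      (H · G) · inv Q                     ≡⟨ cong ((H · G) ·_) Q⁻¹≡-T·PR·T ⟩
      (H · G) · neg ((T · (P · R)) · T)   ≡⟨ neg-·ʳ (H · G) ((T · (P · R)) · T) ⟩
      neg ((H · G) · ((T · (P · R)) · T)) ≡⟨ cong (λ m → neg ((H · G) · m)) (·-assoc T (P · R) T) ⟩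
      neg ((H · G) · (T · ((P · R) · T))) ≡⟨ cong neg (HG·TA≡-A ((P · R) · T)) ⟩
      neg (neg ((P · R) · T))             ≡⟨ neg-involutive-mat ((P · R) · T) ⟩
      (P · R) · T                         ∎

    P⁻¹·HG·Q⁻¹·HG·R⁻¹≡-I : (inv P · ((H · G) · inv Q)) · ((H · G) · inv R) ≡ neg I
    P⁻¹·HG·Q⁻¹·HG·R⁻¹≡-I = begin
      (inv P · ((H · G) · inv Q)) · ((H · G) · inv R)
        ≡⟨ cong (λ m → (inv P · m) · ((H · G) · inv R)) HG·Q⁻¹ ⟩
      (inv P · ((P · R) · T)) · ((H · G) · inv R)
        ≡⟨ cong (_· ((H · G) · inv R)) (sym (·-assoc (inv P) (P · R) T)) ⟩
      ((inv P · (P · R)) · T) · ((H · G) · inv R)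
        ≡⟨ cong (λ m → (m · T) · ((H · G) · inv R)) (inv-cancelˡ P R detP) ⟩
      (R · T) · ((H · G) · inv R)
        ≡⟨ ·-assoc R T ((H · G) · inv R) ⟩
      R · (T · ((H · G) · inv R))
        ≡⟨ cong (R ·_) (T·HGA≡-A (inv R)) ⟩
      R · neg (inv R)
        ≡⟨ neg-·ʳ R (inv R) ⟩
      neg (R · inv R)
        ≡⟨ cong neg (inv-inverseʳ R detR) ⟩
      neg I ∎

    product : (ψ⁻¹ k P · ψ⁻¹ k Q) · ψ⁻¹ k R ≡ T
    product = begin
      (ψ⁻¹ k P · ψ⁻¹ k Q) · ψ⁻¹ k R
        ≡⟨ cong₂ _·_ (cong₂ _·_ (ψ⁻¹≡ϑ∘inv P trP) (ψ⁻¹≡ϑ∘inv Q trQ)) (ψ⁻¹≡ϑ∘inv R trR) ⟩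
      (ϑ (inv P) · ϑ (inv Q)) · ϑ (inv R)
        ≡⟨ cong (_· ϑ (inv R)) (ϑ-· (inv P) (inv Q)) ⟩
      ϑ (inv P · ((H · G) · inv Q)) · ϑ (inv R)
        ≡⟨ ϑ-· (inv P · ((H · G) · inv Q)) (inv R) ⟩
      ϑ ((inv P · ((H · G) · inv Q)) · ((H · G) · inv R))
        ≡⟨ cong ϑ P⁻¹·HG·Q⁻¹·HG·R⁻¹≡-I ⟩
      ϑ (neg I)
        ≡⟨ ϑ-neg-I ⟩
      T ∎

Ψ⁻¹∘Ψ : ∀ k t → Ψ⁻¹ k (Ψ k t) ≡ t
Ψ⁻¹∘Ψ k (X , Y , Z) = triple-cong (ψ⁻¹∘ψ k X) (ψ⁻¹∘ψ k Y) (ψ⁻¹∘ψ k Z)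

Ψ∘Ψ⁻¹ : ∀ k s → Ψ k (Ψ⁻¹ k s) ≡ s
Ψ∘Ψ⁻¹ k (P , Q , R) = triple-cong (ψ∘ψ⁻¹ k P) (ψ∘ψ⁻¹ k Q) (ψ∘ψ⁻¹ k R)

Ψ⁻¹∘Φ-involutive : ∀ k t → MMTriple k t → Ψ⁻¹ k (Φ (Ψ⁻¹ k (Φ t))) ≡ t
Ψ⁻¹∘Φ-involutive k t@(X , Y , Z)
                 ((detX , _ , trX) , (detY , _ , trY) , (detZ , _ , trZ) , XY·Z≡T , _) =
  trans (cong (Ψ⁻¹ k) (Φ∘Ψ⁻¹∘Φ≡Ψ k t weak)) (Ψ⁻¹∘Ψ k t)
  where
  weak : WeakMMTriple k t
  weak = (detX , detY , detZ) , (trX , trY , trZ) , XY·Z≡T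

Φ∘Ψ⁻¹-involutive : ∀ k s → GCTriple k s → Φ (Ψ⁻¹ k (Φ (Ψ⁻¹ k s))) ≡ s
Φ∘Ψ⁻¹-involutive k s gc = trans (Φ∘Ψ⁻¹∘Φ≡Ψ k (Ψ⁻¹ k s) (Ψ⁻¹-WeakMMTriple k s gc)) (Ψ∘Ψ⁻¹ k s)

corollary5p35 : (k : ℕ) →
    -- (Ψ⁻¹ ∘ Φ)² = id on k-MM triples
    ((t : Triple) → MMTriple k t → Ψ⁻¹ k (Φ (Ψ⁻¹ k (Φ t))) ≡ t) ×
    -- (Φ ∘ Ψ⁻¹)² = id on k-GC triples
    ((s : Triple) → GCTriple k s → Φ (Ψ⁻¹ k (Φ (Ψ⁻¹ k s))) ≡ s) ×
    -- Φ⁻¹ = Ψ⁻¹ ∘ Φ ∘ Ψ⁻¹ : both composites with Φ are identities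
    (((t : Triple) → MMTriple k t → (Ψ⁻¹ k (Φ (Ψ⁻¹ k (Φ t)))) ≡ t) ×
     ((s : Triple) → GCTriple k s → Φ (Ψ⁻¹ k (Φ (Ψ⁻¹ k s))) ≡ s))
corollary5p35 k =
  Ψ⁻¹∘Φ-involutive k , Φ∘Ψ⁻¹-involutive k , Ψ⁻¹∘Φ-involutive k , Φ∘Ψ⁻¹-involutive k
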